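{- Let $r\ge1$ be an integer and let $\mathcal{H}$ be a non-empty family of $r$-uniform hypergraphs such that $\min\{s(H): H\in\mathcal{H}\}=1$. Then there exists an integer $C_{\mathcal{H}}$ such that $C_{\mathcal{H}}=\lim_{n\to\infty}\mathrm{wsat}(n,\mathcal{H})$. Moreover, for all $n\ge\max\{|V(H)|: H\in\mathcal{H}\}$, $\mathrm{wsat}(n,\mathcal{H})\ge C_{\mathcal{H}}$.
   Context: An $r$-uniform hypergraph has a finite vertex set and edges that are $r$-element subsets of it; it is non-empty if it has at least one edge. $K_n^r$ is the complete $r$-uniform hypergraph on $n$ vertices. For a non-empty $r$-uniform $H$, the sparseness $s(H)$ is the size of a smallest set $S\subseteq V(H)$ such that exactly one edge of $H$ contains $S$; for empty $H$, $s(H)=-1$. For a non-empty family $\mathcal{H}$ of non-empty $r$-uniform hypergraphs, an $r$-uniform hypergraph $F$ on $n$ vertices is weakly $\mathcal{H}$-saturated if the edges of $E(K_n^r)\setminus E(F)$ can be ordered $e_1,\dots,e_k$ so that for each $i$ there is $H\in\mathcal{H}$ such that $F\cup\{e_1,\dots,e_i\}$ contains a copy of $H$ containing $e_i$; $\mathrm{wsat}(n,\mathcal{H})$ is the minimum number of edges of such an $F$. -}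

module Defs where

open import Data.Nat using (ℕ; _≤_)
open import Data.Fin using (Fin)
open import Data.Fin.Subset as S using (Subset; ∣_∣; _⊆_)
open import Data.List using (List; []; _∷_; length)
open import Data.List.Relation.Unary.All using (All)
open import Data.List.Relation.Unary.Any using (Any)
open import Data.List.Relation.Unary.Unique.Propositional using (Unique)
import Data.List.Membership.Propositional as L
open import Data.Product using (Σ; ∃; ∃-syntax; _×_; proj₁; proj₂; _,_)
open import Data.Unit using (⊤)
open import Relation.Binary.PropositionalEquality using (_≡_)
open import Relation.Nullary using (¬_)
open import Function.Definitions using (Injective)
open import Function.Bundles using (_⇔_)

record HG (r n : ℕ) : Set where
  field
    edges    : List (Subset n)
    distinct : Unique edges
    uniform  : All (λ e → ∣ e ∣ ≡ r) edges
open HG public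

Hypergraph : ℕ → Set
Hypergraph r = Σ ℕ (HG r)

nVert : ∀ {r} → Hypergraph r → ℕ
nVert = proj₁

NonEmpty : ∀ {r} → Hypergraph r → Set
NonEmpty H = ¬ (edges (proj₂ H) ≡ [])

UniqueSuperedge : ∀ {r m} → HG r m → Subset m → Set
UniqueSuperedge H S =
  ∃[ e ] (e L.∈ edges H × S ⊆ e × (∀ e' → e' L.∈ edges H → S ⊆ e' → e' ≡ e))

SparsenessIs : ∀ {r} → Hypergraph r → ℕ → Set
SparsenessIs (m , H) k =
  (∃[ S ] (∣ S ∣ ≡ k × UniqueSuperedge H S)) ×
  (∀ S → UniqueSuperedge H S → k ≤ ∣ S ∣)

MapsOnto : ∀ {m n} → (Fin m → Fin n) → Subset m → Subset n → Set
MapsOnto {m} f d e = ∀ y → (y S.∈ e) ⇔ (∃[ x ] (x S.∈ d × f x ≡ y))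

CopyContaining : ∀ {r m n} → HG r m → List (Subset n) → Subset n → Set
CopyContaining {m = m} {n} H G e =
  ∃[ f ] (Injective _≡_ _≡_ f ×
          (∀ d → d L.∈ edges H → ∃[ e' ] (e' L.∈ G × MapsOnto f d e')) ×
          (∃[ d ] (d L.∈ edges H × MapsOnto f d e)))

SatSeq : ∀ {r n} → List (Hypergraph r) → List (Subset n) → List (Subset n) → Set
SatSeq ℋ G []       = ⊤
SatSeq ℋ G (e ∷ es) =
  Any (λ H → CopyContaining (proj₂ H) (e ∷ G) e) ℋ × SatSeq ℋ (e ∷ G) es

WeaklySaturated : ∀ {r n} → List (Hypergraph r) → HG r n → Set
WeaklySaturated {r} {n} ℋ F =
  ∃[ es ] (Unique es ×
           All (λ e → ∣ e ∣ ≡ r × ¬ (e L.∈ edges F)) es ×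
           (∀ (e : Subset n) → ∣ e ∣ ≡ r → ¬ (e L.∈ edges F) → e L.∈ es) ×
           SatSeq ℋ (edges F) es)

WsatIs : ∀ {r} → List (Hypergraph r) → ℕ → ℕ → Set
WsatIs {r} ℋ n k =
  (∃[ F ] (WeaklySaturated {r} {n} ℋ F × length (edges F) ≡ k)) ×
  (∀ (F : HG r n) → WeaklySaturated ℋ F → k ≤ length (edges F))

-- Fix H ∈ ℋ with s(H) = 1: some vertex v of H lies in exactly one edge e₀.
--
-- If F is weakly ℋ-saturated on n ≥ |V(H)| - 1 vertices, it stays weakly saturated
-- after adding an isolated vertex z: replay the saturation order of F on the old vertices, after which
-- every r-set avoiding z is present, and then add each r-set e through z as the image of e₀ under an
-- embedding of H sending v to z; every other edge of H avoids v and so lands among the old vertices.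
-- Hence wsat(n, ℋ) is non-increasing for n ≥ n₀ = max |V(H)|.
--
-- A weakly saturated F with k edges covers a set U of at most rk vertices. If
-- rk + n₀ ≤ M ≤ n, pull F back to [M] along an injection σ : [M] → [n] whose image contains U. A map
-- g : [n] → [M] that agrees with σ⁻¹ on U and is injective on U together with the vertices of one
-- copy of some H ∈ ℋ carries each step of the saturation of F to a step in [M]; such a g always
-- extends to the next copy since U and the copy take at most rk + n₀ ≤ M vertices. So the
-- pull-back is weakly saturated on M vertices and wsat(M, ℋ) ≤ k.
--
-- With B = e(K_{n₀}^r) ≥ wsat and M = rB + n₀ + 1 this gives wsat(n, ℋ) ≥ wsat(M, ℋ) for n ≥ n₀,
-- with equality for n ≥ M. Weak saturation is decidable (F is weakly saturated iff its greedy closure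
-- contains every r-set), which lets wsat(M, ℋ) be computed as a minimum over all hypergraphs on [M].

module Submission where

open import Defs
open import Data.Nat using (ℕ; zero; suc; _+_; _*_; _∸_; _≤_; _<_; _≥_; z≤n; s≤s; _≤′_; ≤′-refl; ≤′-step)
import Data.Nat.Properties as ℕ
open import Data.Fin using (Fin; zero; suc; _≟_; inject≤)
open import Data.Fin.Base using (finToFun; funToFin)
open import Data.Fin.Properties using (suc-injective; any?; all?; finToFun-funToFin)
import Data.Fin.Permutation.Components as PC
open import Data.Fin.Subset
  using (Subset; inside; outside; ∣_∣; ⊥; ⊤; ⁅_⁆; _∪_; _∩_; ∁; ⋃)
  renaming (_∈_ to _∈ₛ_; _∉_ to _∉ₛ_; _⊆_ to _⊆ₛ_)
open import Data.Fin.Subset.Properties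
  using ( ⊆-antisym; p⊆q⇒∣p∣≤∣q∣; p⊂q⇒∣p∣<∣q∣; nonempty?; Empty-unique; ∉⊥; ∣⊥∣≡0; ∈⊤; ∣⊤∣≡n; ∣p∣≤n
        ; x∈⁅x⁆; x∈⁅y⁆⇒x≡y; x≢y⇒x∉⁅y⁆; x∉⁅y⁆⇒x≢y; ∣⁅x⁆∣≡1; x∈p∪q⁺; x∈p∪q⁻; x∈p∩q⁺; x∈p∩q⁻
        ; x∉p⇒x∈∁p; x∈∁p⇒x∉p; ∣∁p∣≡n∸∣p∣ )
  renaming (_∈?_ to _∈ₛ?_)
open import Data.Vec using ([]; _∷_; here; there; tail)
import Data.Vec.Properties as Vecₚ
open import Data.Bool using (true; false)
import Data.Bool.Properties as Bool
open import Data.List using (List; []; _∷_; length; map; filter; _++_; deduplicate; _ʳ++_)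
import Data.List.Properties as List
open import Data.List.Extrema.Nat using (argmin; argmin-all; f[argmin]≤v⁺; max; xs≤max; max≤v⁺)
open import Data.List.Membership.Propositional using (_∈_; _∉_; find; lose)
open import Data.List.Membership.Propositional.Properties
  using (∈-map⁺; ∈-++⁺ˡ; ∈-++⁺ʳ; ∈-++⁻; ∈-∃++; ∈-filter⁺; ∈-filter⁻; ∈-deduplicate⁺; ∈-deduplicate⁻)
import Data.List.Membership.DecPropositional as DecMembership
open import Data.List.Relation.Binary.Subset.Propositional using (_⊆_)
import Data.List.Relation.Binary.Subset.Propositional.Properties as ⊆ₚ
open import Data.List.Relation.Unary.All as All using (All; []; _∷_)
import Data.List.Relation.Unary.All.Properties as Allₚ
open import Data.List.Relation.Unary.AllPairs using ([]; _∷_)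
open import Data.List.Relation.Unary.Any as Any using (Any; here; there)
import Data.List.Relation.Unary.Any.Properties as Anyₚ
open import Data.List.Relation.Unary.Unique.Propositional using (Unique)
import Data.List.Relation.Unary.Unique.Propositional.Properties as Unique
open import Data.List.Relation.Unary.Unique.DecPropositional.Properties using (deduplicate-!)
open import Data.Product using (Σ; ∃; ∃-syntax; _×_; _,_; proj₁; proj₂)
open import Data.Sum as Sum using (_⊎_; inj₁; inj₂; [_,_]′)
open import Function using (id; _∘_; mk⇔; Equivalence)
open import Function.Definitions using (Injective)
open import Relation.Binary.PropositionalEquality
  using (_≡_; _≢_; _≗_; refl; sym; trans; cong; cong₂; subst; module ≡-Reasoning)
open import Relation.Nullary using (¬_; Dec; yes; no; does; contradiction)
open import Relation.Nullary.Decidable using (map′; ¬?; _×-dec_; _→-dec_)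

private
  variable
    m n r : ℕ

∣p∪q∣≤∣p∣+∣q∣ : (p q : Subset n) → ∣ p ∪ q ∣ ≤ ∣ p ∣ + ∣ q ∣
∣p∪q∣≤∣p∣+∣q∣ [] [] = z≤n
∣p∪q∣≤∣p∣+∣q∣ (inside ∷ p) (inside ∷ q) =
  s≤s (ℕ.≤-trans (∣p∪q∣≤∣p∣+∣q∣ p q) (ℕ.+-monoʳ-≤ ∣ p ∣ (ℕ.n≤1+n ∣ q ∣)))
∣p∪q∣≤∣p∣+∣q∣ (inside ∷ p) (outside ∷ q) = s≤s (∣p∪q∣≤∣p∣+∣q∣ p q)
∣p∪q∣≤∣p∣+∣q∣ (outside ∷ p) (inside ∷ q) =
  ℕ.≤-trans (s≤s (∣p∪q∣≤∣p∣+∣q∣ p q)) (ℕ.≤-reflexive (sym (ℕ.+-suc ∣ p ∣ ∣ q ∣)))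
∣p∪q∣≤∣p∣+∣q∣ (outside ∷ p) (outside ∷ q) = ∣p∪q∣≤∣p∣+∣q∣ p q

∣p∪q∣≡∣p∣+∣q∣ : (p q : Subset n) → (∀ {x} → x ∈ₛ p → x ∉ₛ q) → ∣ p ∪ q ∣ ≡ ∣ p ∣ + ∣ q ∣
∣p∪q∣≡∣p∣+∣q∣ [] [] _ = refl
∣p∪q∣≡∣p∣+∣q∣ (inside ∷ p) (inside ∷ q) disjoint = contradiction here (disjoint here)
∣p∪q∣≡∣p∣+∣q∣ (inside ∷ p) (outside ∷ q) disjoint =
  cong suc (∣p∪q∣≡∣p∣+∣q∣ p q (λ x∈p x∈q → disjoint (there x∈p) (there x∈q)))
∣p∪q∣≡∣p∣+∣q∣ (outside ∷ p) (inside ∷ q) disjoint =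
  trans (cong suc (∣p∪q∣≡∣p∣+∣q∣ p q (λ x∈p x∈q → disjoint (there x∈p) (there x∈q))))
        (sym (ℕ.+-suc _ _))
∣p∪q∣≡∣p∣+∣q∣ (outside ∷ p) (outside ∷ q) disjoint =
  ∣p∪q∣≡∣p∣+∣q∣ p q (λ x∈p x∈q → disjoint (there x∈p) (there x∈q))

∣p∩∁q∣+∣q∣≤∣q∪p∣ : (p q : Subset n) → ∣ p ∩ ∁ q ∣ + ∣ q ∣ ≤ ∣ q ∪ p ∣
∣p∩∁q∣+∣q∣≤∣q∪p∣ p q = begin
  ∣ p ∩ ∁ q ∣ + ∣ q ∣   ≡⟨ ℕ.+-comm ∣ p ∩ ∁ q ∣ ∣ q ∣ ⟩
  ∣ q ∣ + ∣ p ∩ ∁ q ∣   ≡⟨ ∣p∪q∣≡∣p∣+∣q∣ q (p ∩ ∁ q) disjoint ⟨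
  ∣ q ∪ p ∩ ∁ q ∣       ≤⟨ p⊆q⇒∣p∣≤∣q∣ q∪p∩∁q⊆q∪p ⟩
  ∣ q ∪ p ∣             ∎
  where
  open ℕ.≤-Reasoning
  disjoint : ∀ {x} → x ∈ₛ q → x ∉ₛ p ∩ ∁ q
  disjoint x∈q x∈p∩∁q = x∈∁p⇒x∉p (proj₂ (x∈p∩q⁻ p (∁ q) x∈p∩∁q)) x∈q
  q∪p∩∁q⊆q∪p : q ∪ p ∩ ∁ q ⊆ₛ q ∪ p
  q∪p∩∁q⊆q∪p x∈ = x∈p∪q⁺ (Sum.map₂ (proj₁ ∘ x∈p∩q⁻ p (∁ q)) (x∈p∪q⁻ q (p ∩ ∁ q) x∈))

p⊆q∧∣q∣≤∣p∣⇒p≡q : {p q : Subset n} → p ⊆ₛ q → ∣ q ∣ ≤ ∣ p ∣ → p ≡ q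
p⊆q∧∣q∣≤∣p∣⇒p≡q {p = p} {q} p⊆q ∣q∣≤∣p∣ = ⊆-antisym p⊆q q⊆p
  where
  q⊆p : q ⊆ₛ p
  q⊆p {x} x∈q with x ∈ₛ? p
  ... | yes x∈p = x∈p
  ... | no x∉p = contradiction ∣q∣≤∣p∣ (ℕ.<⇒≱ (p⊂q⇒∣p∣<∣q∣ (p⊆q , x , x∈q , x∉p)))

∣p∣≡1⇒p≡⁅x⁆ : (p : Subset n) → ∣ p ∣ ≡ 1 → ∃[ x ] p ≡ ⁅ x ⁆
∣p∣≡1⇒p≡⁅x⁆ {n} p ∣p∣≡1 with nonempty? p
... | no empty = contradiction (trans (sym ∣p∣≡1) (trans (cong ∣_∣ (Empty-unique empty)) (∣⊥∣≡0 n))) λ ()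
... | yes (x , x∈p) = x , sym (p⊆q∧∣q∣≤∣p∣⇒p≡q ⁅x⁆⊆p (ℕ.≤-reflexive (trans ∣p∣≡1 (sym (∣⁅x⁆∣≡1 x)))))
  where
  ⁅x⁆⊆p : ⁅ x ⁆ ⊆ₛ p
  ⁅x⁆⊆p y∈⁅x⁆ = subst (_∈ₛ p) (sym (x∈⁅y⁆⇒x≡y x y∈⁅x⁆)) x∈p

∣p∣≤1+∣p∩∁⁅x⁆∣ : (p : Subset n) (x : Fin n) → ∣ p ∣ ≤ suc ∣ p ∩ ∁ ⁅ x ⁆ ∣
∣p∣≤1+∣p∩∁⁅x⁆∣ p x = ℕ.≤-trans (p⊆q⇒∣p∣≤∣q∣ p⊆) (ℕ.≤-trans (∣p∪q∣≤∣p∣+∣q∣ ⁅ x ⁆ _)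
                                  (ℕ.≤-reflexive (cong (_+ ∣ p ∩ ∁ ⁅ x ⁆ ∣) (∣⁅x⁆∣≡1 x))))
  where
  p⊆ : p ⊆ₛ ⁅ x ⁆ ∪ (p ∩ ∁ ⁅ x ⁆)
  p⊆ {y} y∈p with y ≟ x
  ... | yes refl = x∈p∪q⁺ (inj₁ (x∈⁅x⁆ x))
  ... | no y≢x   = x∈p∪q⁺ (inj₂ (x∈p∩q⁺ (y∈p , x∉p⇒x∈∁p (x≢y⇒x∉⁅y⁆ y≢x))))

subsetOfSize : ∀ {k} m → k ≤ m → Σ (Subset m) λ A → ∣ A ∣ ≡ k
subsetOfSize {zero}  m       _         = ⊥ , ∣⊥∣≡0 m
subsetOfSize {suc k} (suc m) (s≤s k≤m) with subsetOfSize m k≤m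
... | A , ∣A∣≡k = inside ∷ A , cong suc ∣A∣≡k

∈⇒⊆⋃ : {d : Subset n} {ds : List (Subset n)} → d ∈ ds → d ⊆ₛ ⋃ ds
∈⇒⊆⋃ (here refl) x∈d = x∈p∪q⁺ (inj₁ x∈d)
∈⇒⊆⋃ (there d∈ds) x∈d = x∈p∪q⁺ (inj₂ (∈⇒⊆⋃ d∈ds x∈d))

∣⋃∣≤ : ∀ {r} (ds : List (Subset n)) → All (λ d → ∣ d ∣ ≡ r) ds → ∣ ⋃ ds ∣ ≤ r * length ds
∣⋃∣≤ {n} {r} [] [] = ℕ.≤-reflexive (trans (∣⊥∣≡0 n) (sym (ℕ.*-zeroʳ r)))
∣⋃∣≤ {r = r} (d ∷ ds) (∣d∣≡r ∷ ∣ds∣≡r) = begin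
  ∣ d ∪ ⋃ ds ∣           ≤⟨ ∣p∪q∣≤∣p∣+∣q∣ d (⋃ ds) ⟩
  ∣ d ∣ + ∣ ⋃ ds ∣       ≤⟨ ℕ.+-mono-≤ (ℕ.≤-reflexive ∣d∣≡r) (∣⋃∣≤ ds ∣ds∣≡r) ⟩
  r + r * length ds      ≡⟨ ℕ.*-suc r (length ds) ⟨
  r * suc (length ds)    ∎
  where open ℕ.≤-Reasoning

image : (Fin m → Fin n) → Subset m → Subset n
image f []            = ⊥
image f (outside ∷ d) = image (f ∘ suc) d
image f (inside ∷ d)  = ⁅ f zero ⁆ ∪ image (f ∘ suc) d

∈-image⁺ : (f : Fin m → Fin n) {d : Subset m} {x : Fin m} → x ∈ₛ d → f x ∈ₛ image f d
∈-image⁺ f {inside ∷ d}  here        = x∈p∪q⁺ (inj₁ (x∈⁅x⁆ (f zero)))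
∈-image⁺ f {inside ∷ d}  (there x∈d) = x∈p∪q⁺ (inj₂ (∈-image⁺ (f ∘ suc) x∈d))
∈-image⁺ f {outside ∷ d} (there x∈d) = ∈-image⁺ (f ∘ suc) x∈d

∈-image⁻ : (f : Fin m → Fin n) (d : Subset m) {y : Fin n} →
           y ∈ₛ image f d → ∃[ x ] (x ∈ₛ d × f x ≡ y)
∈-image⁻ f [] y∈ = contradiction y∈ ∉⊥
∈-image⁻ f (outside ∷ d) y∈ with ∈-image⁻ (f ∘ suc) d y∈
... | x , x∈d , fx≡y = suc x , there x∈d , fx≡y
∈-image⁻ f (inside ∷ d) y∈ with x∈p∪q⁻ ⁅ f zero ⁆ (image (f ∘ suc) d) y∈
... | inj₁ y∈⁅f0⁆ = zero , here , sym (x∈⁅y⁆⇒x≡y (f zero) y∈⁅f0⁆)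
... | inj₂ y∈′ with ∈-image⁻ (f ∘ suc) d y∈′
...   | x , x∈d , fx≡y = suc x , there x∈d , fx≡y

MapsOnto-image : (f : Fin m → Fin n) (d : Subset m) → MapsOnto f d (image f d)
MapsOnto-image f d y = mk⇔ (∈-image⁻ f d) λ where (x , x∈d , refl) → ∈-image⁺ f x∈d

MapsOnto⇒≡image : {f : Fin m → Fin n} {d : Subset m} {e : Subset n} →
                  MapsOnto f d e → e ≡ image f d
MapsOnto⇒≡image {f = f} {d} onto = ⊆-antisym
  (λ {y} y∈e → Equivalence.from (MapsOnto-image f d y) (Equivalence.to (onto y) y∈e))
  (λ {y} y∈ → Equivalence.from (onto y) (∈-image⁻ f d y∈))

image-cong : {f g : Fin m → Fin n} (d : Subset m) → (∀ {x} → x ∈ₛ d → f x ≡ g x) →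
             image f d ≡ image g d
image-cong []            f≗g = refl
image-cong (outside ∷ d) f≗g = image-cong d (f≗g ∘ there)
image-cong (inside ∷ d)  f≗g = cong₂ _∪_ (cong ⁅_⁆ (f≗g here)) (image-cong d (f≗g ∘ there))

image-id : (d : Subset n) → image (λ x → x) d ≡ d
image-id d = sym (MapsOnto⇒≡image λ y → mk⇔ (λ y∈d → y , y∈d , refl) λ where (x , x∈d , refl) → x∈d)

image-∘ : ∀ {k} (g : Fin n → Fin k) (f : Fin m → Fin n) (d : Subset m) →
          image (g ∘ f) d ≡ image g (image f d)
image-∘ g f d = sym (MapsOnto⇒≡image λ z → mk⇔
  (λ z∈ → let y , y∈ , gy≡z = ∈-image⁻ g (image f d) z∈
              x , x∈d , fx≡y = ∈-image⁻ f d y∈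
          in x , x∈d , trans (cong g fx≡y) gy≡z)
  (λ where (x , x∈d , refl) → ∈-image⁺ g (∈-image⁺ f x∈d)))

image-⊆ : (f : Fin m → Fin n) {d : Subset m} {e : Subset n} →
          (∀ {x} → x ∈ₛ d → f x ∈ₛ e) → image f d ⊆ₛ e
image-⊆ f {d} f[d]⊆e y∈ with ∈-image⁻ f d y∈
... | x , x∈d , refl = f[d]⊆e x∈d

image⊆range : (f : Fin m → Fin n) (d : Subset m) → image f d ⊆ₛ image f ⊤
image⊆range f d = image-⊆ f {d} (λ _ → ∈-image⁺ f ∈⊤)

InjectiveOn : (Fin m → Fin n) → Subset m → Set
InjectiveOn f d = ∀ {x y} → x ∈ₛ d → y ∈ₛ d → f x ≡ f y → x ≡ y

∣image∣≡∣d∣ : (f : Fin m → Fin n) (d : Subset m) → InjectiveOn f d → ∣ image f d ∣ ≡ ∣ d ∣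
∣image∣≡∣d∣ {n = n} f [] _ = ∣⊥∣≡0 n
∣image∣≡∣d∣ f (outside ∷ d) inj =
  ∣image∣≡∣d∣ (f ∘ suc) d (λ x∈ y∈ → suc-injective ∘ inj (there x∈) (there y∈))
∣image∣≡∣d∣ f (inside ∷ d) inj = begin
  ∣ ⁅ f zero ⁆ ∪ image (f ∘ suc) d ∣       ≡⟨ ∣p∪q∣≡∣p∣+∣q∣ _ _ fresh ⟩
  ∣ ⁅ f zero ⁆ ∣ + ∣ image (f ∘ suc) d ∣   ≡⟨ cong₂ _+_ (∣⁅x⁆∣≡1 (f zero)) ih ⟩
  suc ∣ d ∣                                ∎
  where
  open ≡-Reasoning
  ih : ∣ image (f ∘ suc) d ∣ ≡ ∣ d ∣
  ih = ∣image∣≡∣d∣ (f ∘ suc) d (λ x∈ y∈ → suc-injective ∘ inj (there x∈) (there y∈))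
  fresh : ∀ {y} → y ∈ₛ ⁅ f zero ⁆ → y ∉ₛ image (f ∘ suc) d
  fresh y∈⁅f0⁆ y∈ with ∈-image⁻ (f ∘ suc) d y∈
  ... | x , x∈d , fx≡y with inj (there x∈d) here (trans fx≡y (x∈⁅y⁆⇒x≡y _ y∈⁅f0⁆))
  ...   | ()

image-onto : (f : Fin m → Fin n) {A : Subset m} {B : Subset n} → InjectiveOn f A →
         (∀ {x} → x ∈ₛ A → f x ∈ₛ B) → ∣ B ∣ ≤ ∣ A ∣ → image f A ≡ B
image-onto f {A} f-inj f[A]⊆B ∣B∣≤∣A∣ =
  p⊆q∧∣q∣≤∣p∣⇒p≡q (image-⊆ f f[A]⊆B) (ℕ.≤-trans ∣B∣≤∣A∣ (ℕ.≤-reflexive (sym (∣image∣≡∣d∣ f A f-inj))))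

-- default is the value taken outside A
injectInto : (A : Subset m) (B : Subset n) → ∣ A ∣ ≤ ∣ B ∣ → Fin n →
             ∃[ h ] (InjectiveOn h A × (∀ {x} → x ∈ₛ A → h x ∈ₛ B))
injectInto [] B _ _ = (λ ()) , (λ ()) , λ ()
injectInto (outside ∷ A) B ∣A∣≤∣B∣ default with injectInto A B ∣A∣≤∣B∣ default
... | h , inj , h[A]⊆B = h′ , inj′ , λ where (there x∈A) → h[A]⊆B x∈A
  where
  h′ : Fin (suc _) → Fin _
  h′ zero    = default
  h′ (suc x) = h x
  inj′ : InjectiveOn h′ (outside ∷ A)
  inj′ (there x∈A) (there y∈A) hx≡hy = cong suc (inj x∈A y∈A hx≡hy)
injectInto {n = n} (inside ∷ A) B ∣A∣<∣B∣ default with nonempty? B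
... | no B-empty = contradiction (ℕ.≤-trans ∣A∣<∣B∣ (ℕ.≤-reflexive ∣B∣≡0)) λ ()
  where
  ∣B∣≡0 : ∣ B ∣ ≡ 0
  ∣B∣≡0 = trans (cong ∣_∣ (Empty-unique B-empty)) (∣⊥∣≡0 n)
... | yes (t , t∈B) with injectInto A (B ∩ ∁ ⁅ t ⁆)
                          (ℕ.≤-pred (ℕ.≤-trans ∣A∣<∣B∣ (∣p∣≤1+∣p∩∁⁅x⁆∣ B t))) default
...   | h , inj , h[A]⊆B-t = h′ , inj′ , h′[A]⊆B
  where
  h[A]∌t : ∀ {x} → x ∈ₛ A → h x ≢ t
  h[A]∌t x∈A = x∉⁅y⁆⇒x≢y (x∈∁p⇒x∉p (proj₂ (x∈p∩q⁻ B _ (h[A]⊆B-t x∈A))))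
  h′ : Fin (suc _) → Fin _
  h′ zero    = t
  h′ (suc x) = h x
  inj′ : InjectiveOn h′ (inside ∷ A)
  inj′ here        here        _     = refl
  inj′ here        (there y∈A) t≡hy  = contradiction (sym t≡hy) (h[A]∌t y∈A)
  inj′ (there x∈A) here        hx≡t  = contradiction hx≡t (h[A]∌t x∈A)
  inj′ (there x∈A) (there y∈A) hx≡hy = cong suc (inj x∈A y∈A hx≡hy)
  h′[A]⊆B : ∀ {x} → x ∈ₛ inside ∷ A → h′ x ∈ₛ B
  h′[A]⊆B here        = t∈B
  h′[A]⊆B (there x∈A) = proj₁ (x∈p∩q⁻ B _ (h[A]⊆B-t x∈A))

extendInjection : (g : Fin m → Fin n) (D T : Subset m) → InjectiveOn g D → ∣ D ∪ T ∣ ≤ n → Fin n →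
                  ∃[ g′ ] (InjectiveOn g′ (D ∪ T) × (∀ {x} → x ∈ₛ D → g′ x ≡ g x))
extendInjection {n = n} g D T g-inj ∣D∪T∣≤n default = g′ , g′-inj , g′-agrees
  where
  new = T ∩ ∁ D
  free = ∁ (image g D)
  ∣new∣≤∣free∣ : ∣ new ∣ ≤ ∣ free ∣
  ∣new∣≤∣free∣ = begin
    ∣ new ∣               ≤⟨ ℕ.m+n≤o⇒m≤o∸n ∣ new ∣ (ℕ.≤-trans (∣p∩∁q∣+∣q∣≤∣q∪p∣ T D) ∣D∪T∣≤n) ⟩
    n ∸ ∣ D ∣             ≡⟨ cong (n ∸_) (∣image∣≡∣d∣ g D g-inj) ⟨
    n ∸ ∣ image g D ∣     ≡⟨ ∣∁p∣≡n∸∣p∣ (image g D) ⟨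
    ∣ free ∣              ∎
    where open ℕ.≤-Reasoning
  h = injectInto new free ∣new∣≤∣free∣ default
  g′ : Fin _ → Fin n
  g′ x with x ∈ₛ? D
  ... | yes _ = g x
  ... | no _  = proj₁ h x
  g′-agrees : ∀ {x} → x ∈ₛ D → g′ x ≡ g x
  g′-agrees {x} x∈D with x ∈ₛ? D
  ... | yes _   = refl
  ... | no x∉D = contradiction x∈D x∉D
  ∈new : ∀ {x} → x ∈ₛ D ∪ T → x ∉ₛ D → x ∈ₛ new
  ∈new {x} x∈ x∉D with x∈p∪q⁻ D T x∈
  ... | inj₁ x∈D = contradiction x∈D x∉D
  ... | inj₂ x∈T = x∈p∩q⁺ (x∈T , x∉p⇒x∈∁p x∉D)
  old≢new : ∀ {x y} → x ∈ₛ D → y ∈ₛ new → g x ≢ proj₁ h y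
  old≢new x∈D y∈new gx≡hy = x∈∁p⇒x∉p (proj₂ (proj₂ h) y∈new) (subst (_∈ₛ image g D) gx≡hy (∈-image⁺ g x∈D))
  g′-inj : InjectiveOn g′ (D ∪ T)
  g′-inj {x} {y} x∈ y∈ g′x≡g′y with x ∈ₛ? D | y ∈ₛ? D
  ... | yes x∈D | yes y∈D = g-inj x∈D y∈D g′x≡g′y
  ... | yes x∈D | no y∉D  = contradiction g′x≡g′y (old≢new x∈D (∈new y∈ y∉D))
  ... | no x∉D  | yes y∈D = contradiction (sym g′x≡g′y) (old≢new y∈D (∈new x∈ x∉D))
  ... | no x∉D  | no y∉D  = proj₁ (proj₂ h) (∈new x∈ x∉D) (∈new y∈ y∉D) g′x≡g′y

injectionOnto : (A : Subset m) (B : Subset n) → ∣ A ∣ ≡ ∣ B ∣ → m ≤ n → Fin n →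
                ∃[ f ] (Injective _≡_ _≡_ f × image f A ≡ B)
injectionOnto {m} A B ∣A∣≡∣B∣ m≤n default
  with injectInto A B (ℕ.≤-reflexive ∣A∣≡∣B∣) default
... | h , h-inj , h[A]⊆B
  with extendInjection h A ⊤ h-inj (ℕ.≤-trans (∣p∣≤n (A ∪ ⊤)) m≤n) default
...   | f , f-inj , f≗h = f , f-inj (x∈p∪q⁺ (inj₂ ∈⊤)) (x∈p∪q⁺ (inj₂ ∈⊤)) ,
        image-onto f (λ x∈A y∈A → f-inj (x∈p∪q⁺ (inj₁ x∈A)) (x∈p∪q⁺ (inj₁ y∈A)))
          (λ x∈A → subst (_∈ₛ B) (sym (f≗h x∈A)) (h[A]⊆B x∈A)) (ℕ.≤-reflexive (sym ∣A∣≡∣B∣))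

transpose-injective : (i j : Fin n) → Injective _≡_ _≡_ (PC.transpose i j)
transpose-injective i j {x} {y} τx≡τy =
  trans (sym (PC.transpose-inverse j i)) (trans (cong (PC.transpose j i) τx≡τy) (PC.transpose-inverse j i))

transpose-matchˡ : (i j : Fin n) → PC.transpose i j i ≡ j
transpose-matchˡ i j with i ≟ i
... | yes _   = refl
... | no i≢i = contradiction refl i≢i

transpose-∈ : {i j k : Fin n} {B : Subset n} → i ∈ₛ B → j ∈ₛ B → k ∈ₛ B → PC.transpose i j k ∈ₛ B
transpose-∈ {i = i} {j} {k} i∈B j∈B k∈B with does (k ≟ i)
... | true = j∈B
... | false with does (k ≟ j)
...   | true  = i∈B
...   | false = k∈B

injectionOnto-sending : (A : Subset m) (B : Subset n) {a : Fin m} {b : Fin n} → a ∈ₛ A → b ∈ₛ B →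
                        ∣ A ∣ ≡ ∣ B ∣ → m ≤ n →
                        ∃[ f ] (Injective _≡_ _≡_ f × image f A ≡ B × f a ≡ b)
injectionOnto-sending A B {a} {b} a∈A b∈B ∣A∣≡∣B∣ m≤n with injectionOnto A B ∣A∣≡∣B∣ m≤n b
... | f , f-inj , f[A]≡B = τ ∘ f , f-inj ∘ transpose-injective (f a) b , τf[A]≡B , transpose-matchˡ (f a) b
  where
  τ = PC.transpose (f a) b
  f[A]⊆B : ∀ {x} → x ∈ₛ A → f x ∈ₛ B
  f[A]⊆B x∈A = subst (f _ ∈ₛ_) f[A]≡B (∈-image⁺ f x∈A)
  τf[A]≡B : image (τ ∘ f) A ≡ B
  τf[A]≡B = image-onto (τ ∘ f) (λ _ _ → f-inj ∘ transpose-injective (f a) b)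
              (λ x∈A → transpose-∈ (f[A]⊆B a∈A) b∈B (f[A]⊆B x∈A))
              (ℕ.≤-reflexive (sym ∣A∣≡∣B∣))

leftInverse : (σ : Fin m → Fin n) → Injective _≡_ _≡_ σ → Fin m → ∃[ ρ ] (∀ x → ρ (σ x) ≡ x)
leftInverse σ σ-inj default = ρ , ρ∘σ
  where
  ρ : Fin _ → Fin _
  ρ y with any? (λ x → σ x ≟ y)
  ... | yes (x , _) = x
  ... | no _        = default
  ρ∘σ : ∀ x → ρ (σ x) ≡ x
  ρ∘σ x with any? (λ x′ → σ x′ ≟ σ x)
  ... | yes (_ , σx′≡σx) = σ-inj σx′≡σx
  ... | no none          = contradiction (x , refl) none

_≟ₛ_ : (p q : Subset n) → Dec (p ≡ q)
_≟ₛ_ = Vecₚ.≡-dec Bool._≟_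

_∈?_ : (e : Subset n) (G : List (Subset n)) → Dec (e ∈ G)
_∈?_ = DecMembership._∈?_ _≟ₛ_

subsets : ∀ n → List (Subset n)
subsets zero    = [] ∷ []
subsets (suc n) = map (inside ∷_) (subsets n) ++ map (outside ∷_) (subsets n)

∈-subsets : (p : Subset n) → p ∈ subsets n
∈-subsets []            = here refl
∈-subsets (inside ∷ p)  = ∈-++⁺ˡ (∈-map⁺ (inside ∷_) (∈-subsets p))
∈-subsets (outside ∷ p) = ∈-++⁺ʳ _ (∈-map⁺ (outside ∷_) (∈-subsets p))

ofSize? : ∀ r (e : Subset n) → Dec (∣ e ∣ ≡ r)
ofSize? r e = ℕ._≟_ ∣ e ∣ r

hypergraphOn : ∀ r → List (Subset n) → HG r n
hypergraphOn r es = record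
  { edges    = deduplicate _≟ₛ_ (filter (ofSize? r) es)
  ; distinct = deduplicate-! _≟ₛ_ (filter (ofSize? r) es)
  ; uniform  = All.tabulate λ e∈ →
      proj₂ (∈-filter⁻ (ofSize? r) {xs = es} (∈-deduplicate⁻ _≟ₛ_ (filter (ofSize? r) es) e∈))
  }

∈-hypergraphOn⁺ : {es : List (Subset n)} {e : Subset n} → e ∈ es → ∣ e ∣ ≡ r →
                  e ∈ edges (hypergraphOn r es)
∈-hypergraphOn⁺ e∈es ∣e∣≡r = ∈-deduplicate⁺ _≟ₛ_ (∈-filter⁺ (ofSize? _) e∈es ∣e∣≡r)

∈-hypergraphOn⁻ : {es : List (Subset n)} {e : Subset n} → e ∈ edges (hypergraphOn r es) → e ∈ es
∈-hypergraphOn⁻ {r = r} {es = es} e∈ =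
  proj₁ (∈-filter⁻ (ofSize? r) {xs = es} (∈-deduplicate⁻ _≟ₛ_ (filter (ofSize? r) es) e∈))

∣hypergraphOn∣≤ : ∀ r (es : List (Subset n)) → length (edges (hypergraphOn r es)) ≤ length es
∣hypergraphOn∣≤ r es =
  ℕ.≤-trans (List.length-deduplicate _≟ₛ_ (filter (ofSize? r) es)) (List.length-filter (ofSize? r) es)

completeHG : ∀ r n → HG r n
completeHG r n = hypergraphOn r (subsets n)

sublists : {A : Set} → List A → List (List A)
sublists []       = [] ∷ []
sublists (x ∷ xs) = map (x ∷_) (sublists xs) ++ sublists xs

filter∈sublists : {A : Set} {P : A → Set} (P? : ∀ x → Dec (P x)) (xs : List A) →
                  filter P? xs ∈ sublists xs
filter∈sublists P? []       = here refl
filter∈sublists P? (x ∷ xs) with P? x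
... | yes _ = ∈-++⁺ˡ (∈-map⁺ (x ∷_) (filter∈sublists P? xs))
... | no _  = ∈-++⁺ʳ _ (filter∈sublists P? xs)

Unique⇒length≤ : {A : Set} {xs ys : List A} → Unique xs → xs ⊆ ys → length xs ≤ length ys
Unique⇒length≤ {xs = []} _ _ = z≤n
Unique⇒length≤ {xs = x ∷ xs} {ys} (x∉xs ∷ xs!) xs⊆ys with ∈-∃++ (xs⊆ys (here refl))
... | ys₁ , ys₂ , refl =
  ℕ.≤-trans (s≤s (Unique⇒length≤ xs! xs⊆ys₁++ys₂)) (ℕ.≤-reflexive (sym (List.length-++-sucʳ ys₁ x ys₂)))
  where
  xs⊆ys₁++ys₂ : ∀ {z} → z ∈ xs → z ∈ ys₁ ++ ys₂
  xs⊆ys₁++ys₂ z∈xs with ∈-++⁻ ys₁ (xs⊆ys (there z∈xs))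
  ... | inj₁ z∈ys₁          = ∈-++⁺ˡ z∈ys₁
  ... | inj₂ (here z≡x)     = contradiction (sym z≡x) (All.lookup x∉xs z∈xs)
  ... | inj₂ (there z∈ys₂) = ∈-++⁺ʳ ys₁ z∈ys₂

∃-fun? : {P : (Fin m → Fin n) → Set} → (∀ f → Dec (P f)) → (∀ {f g} → f ≗ g → P f → P g) →
         Dec (∃ P)
∃-fun? P? P-resp = map′ (λ (i , p) → finToFun i , p)
                        (λ (f , p) → funToFin f , P-resp (sym ∘ finToFun-funToFin f) p)
                        (any? (P? ∘ finToFun))

injective? : (f : Fin m → Fin n) → Dec (Injective _≡_ _≡_ f)
injective? f = map′ (λ inj {x} {y} → inj x y) (λ inj x y → inj)
                    (all? λ x → all? λ y → (f x ≟ f y) →-dec (x ≟ y))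

IsCopy : HG r m → List (Subset n) → Subset n → (Fin m → Fin n) → Set
IsCopy H G e f = Injective _≡_ _≡_ f × All (λ d → image f d ∈ G) (edges H) ×
                 Any (λ d → image f d ≡ e) (edges H)

IsCopy⇒CopyContaining : {H : HG r m} {G : List (Subset n)} {e : Subset n} {f : Fin m → Fin n} →
                        IsCopy H G e f → CopyContaining H G e
IsCopy⇒CopyContaining {f = f} (f-inj , f[H]⊆G , e∈f[H]) =
  f , f-inj ,
  (λ d d∈H → image f d , All.lookup f[H]⊆G d∈H , MapsOnto-image f d) ,
  (let d , d∈H , f[d]≡e = find e∈f[H] in d , d∈H , subst (MapsOnto f d) f[d]≡e (MapsOnto-image f d))

CopyContaining⇒IsCopy : {H : HG r m} {G : List (Subset n)} {e : Subset n} →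
                        CopyContaining H G e → ∃ (IsCopy H G e)
CopyContaining⇒IsCopy {G = G} (f , f-inj , f[H]⊆G , d , d∈H , f[d]=e) =
  f , f-inj ,
  All.tabulate (λ d′∈H → let e′ , e′∈G , f[d′]=e′ = f[H]⊆G _ d′∈H in
                         subst (_∈ G) (MapsOnto⇒≡image f[d′]=e′) e′∈G) ,
  lose d∈H (sym (MapsOnto⇒≡image f[d]=e))

IsCopy-resp-≗ : {H : HG r m} {G : List (Subset n)} {e : Subset n} {f g : Fin m → Fin n} →
                f ≗ g → IsCopy H G e f → IsCopy H G e g
IsCopy-resp-≗ {G = G} {e} {f} {g} f≗g (f-inj , f[H]⊆G , e∈f[H]) =
  (λ {x} {y} gx≡gy → f-inj (trans (f≗g x) (trans gx≡gy (sym (f≗g y))))) ,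
  All.map (λ {d} → subst (_∈ G) (f[d]≡g[d] d)) f[H]⊆G ,
  Any.map (λ {d} → trans (sym (f[d]≡g[d] d))) e∈f[H]
  where
  f[d]≡g[d] : ∀ d → image f d ≡ image g d
  f[d]≡g[d] d = image-cong d (λ {x} _ → f≗g x)

copy? : (H : HG r m) (G : List (Subset n)) (e : Subset n) → Dec (CopyContaining H G e)
copy? H G e = map′ (λ (f , c) → IsCopy⇒CopyContaining {H = H} c) (CopyContaining⇒IsCopy {H = H})
                   (∃-fun? isCopy? (IsCopy-resp-≗ {H = H}))
  where
  isCopy? : ∀ f → Dec (IsCopy H G e f)
  isCopy? f = injective? f ×-dec All.all? (λ d → image f d ∈? G) (edges H)
                           ×-dec Any.any? (λ d → image f d ≟ₛ e) (edges H)

copy-size : {H : HG r m} {G : List (Subset n)} {e : Subset n} → CopyContaining H G e → ∣ e ∣ ≡ r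
copy-size {H = H} c with CopyContaining⇒IsCopy {H = H} c
... | f , f-inj , _ , e∈f[H] with find e∈f[H]
...   | d , d∈H , refl = trans (∣image∣≡∣d∣ f d (λ _ _ → f-inj)) (All.lookup (uniform H) d∈H)

copy-mono : (H : HG r m) {G G′ : List (Subset n)} {e : Subset n} → G ⊆ G′ →
            CopyContaining H G e → CopyContaining H G′ e
copy-mono H G⊆G′ (f , f-inj , f[H]⊆G , e∈f[H]) =
  f , f-inj , (λ d d∈H → let e′ , e′∈G , onto = f[H]⊆G d d∈H in e′ , G⊆G′ e′∈G , onto) , e∈f[H]

copy-image : ∀ {k} {H : HG r m} {G : List (Subset n)} {e : Subset n} (g : Fin n → Fin k) →
             Injective _≡_ _≡_ g → CopyContaining H G e → CopyContaining H (map (image g) G) (image g e)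
copy-image {H = H} g g-inj c with CopyContaining⇒IsCopy {H = H} c
... | f , f-inj , f[H]⊆G , e∈f[H] = IsCopy⇒CopyContaining {H = H} {f = g ∘ f}
  ( f-inj ∘ g-inj
  , All.map (λ {d} f[d]∈G → subst (_∈ _) (sym (image-∘ g f d)) (∈-map⁺ (image g) f[d]∈G)) f[H]⊆G
  , Any.map (λ {d} f[d]≡e → trans (image-∘ g f d) (cong (image g) f[d]≡e)) e∈f[H] )

Complete : ∀ r → List (Subset n) → Set
Complete r G = ∀ e → ∣ e ∣ ≡ r → e ∈ G

complete? : ∀ r (G : List (Subset n)) → Dec (Complete r G)
complete? {n} r G = map′ (λ all e ∣e∣≡r → All.lookup all (∈-hypergraphOn⁺ (∈-subsets e) ∣e∣≡r))
                         (λ compl → All.tabulate λ {e} e∈ →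
                                      compl e (All.lookup (uniform (completeHG r n)) e∈))
                         (All.all? (_∈? G) (edges (completeHG r n)))

∈-ʳ++⁺ˡ : {A : Set} {x : A} {xs : List A} (ys : List A) → x ∈ xs → x ∈ xs ʳ++ ys
∈-ʳ++⁺ˡ {xs = xs} ys x∈xs = Anyₚ.reverseAcc⁺ ys xs (inj₂ x∈xs)

∈-ʳ++⁺ʳ : {A : Set} {x : A} (xs : List A) {ys : List A} → x ∈ ys → x ∈ xs ʳ++ ys
∈-ʳ++⁺ʳ xs {ys} x∈ys = Anyₚ.reverseAcc⁺ ys xs (inj₁ x∈ys)

∈-ʳ++⁻ : {A : Set} {x : A} (xs : List A) {ys : List A} → x ∈ xs ʳ++ ys → x ∈ xs ⊎ x ∈ ys
∈-ʳ++⁻ xs {ys} x∈ = Sum.swap (Anyₚ.reverseAcc⁻ ys xs x∈)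

module _ (ℋ : List (Hypergraph r)) where

  Addable : List (Subset n) → Subset n → Set
  Addable G e = Any (λ H → CopyContaining (proj₂ H) (e ∷ G) e) ℋ

  Closed : List (Subset n) → Set
  Closed G = ∀ e → Addable G e → e ∈ G

  addable? : (G : List (Subset n)) (e : Subset n) → Dec (Addable G e)
  addable? G e = Any.any? (λ H → copy? (proj₂ H) (e ∷ G) e) ℋ

  Addable-size : {G : List (Subset n)} {e : Subset n} → Addable G e → ∣ e ∣ ≡ r
  Addable-size addable = let H , _ , c = find addable in copy-size {H = proj₂ H} c

  Addable-mono : {G G′ : List (Subset n)} {e : Subset n} → G ⊆ G′ → Addable G e → Addable G′ e
  Addable-mono G⊆G′ = Any.map λ {H} → copy-mono (proj₂ H) (⊆ₚ.∷⁺ʳ _ G⊆G′)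

  SatSeq-mono : {G G′ : List (Subset n)} (es : List (Subset n)) → G ⊆ G′ → SatSeq ℋ G es → SatSeq ℋ G′ es
  SatSeq-mono []       _     _                = _
  SatSeq-mono (e ∷ es) G⊆G′ (addable , sat) =
    Addable-mono G⊆G′ addable , SatSeq-mono es (⊆ₚ.∷⁺ʳ e G⊆G′) sat

  SatSeq-++ : {G : List (Subset n)} (es fs : List (Subset n)) →
              SatSeq ℋ G es → SatSeq ℋ (es ʳ++ G) fs → SatSeq ℋ G (es ++ fs)
  SatSeq-++ []       fs _                 sat′ = sat′
  SatSeq-++ (e ∷ es) fs (addable , sat) sat′ = addable , SatSeq-++ es fs sat sat′

  SatSeq-image : ∀ {k} {G : List (Subset n)} (g : Fin n → Fin k) → Injective _≡_ _≡_ g →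
                 (es : List (Subset n)) → SatSeq ℋ G es → SatSeq ℋ (map (image g) G) (map (image g) es)
  SatSeq-image g g-inj []       _                = _
  SatSeq-image g g-inj (e ∷ es) (addable , sat) =
    Any.map (λ {H} → copy-image {H = proj₂ H} g g-inj) addable , SatSeq-image g g-inj es sat

  SatSeq-sizes : {G : List (Subset n)} (es : List (Subset n)) → SatSeq ℋ G es → All (λ e → ∣ e ∣ ≡ r) es
  SatSeq-sizes []       _                = []
  SatSeq-sizes (e ∷ es) (addable , sat) = Addable-size addable ∷ SatSeq-sizes es sat

  SatSeq-closed : {G G′ : List (Subset n)} (es : List (Subset n)) → G ⊆ G′ → Closed G′ →
                  SatSeq ℋ G es → es ʳ++ G ⊆ G′
  SatSeq-closed []       G⊆G′ _      _                = G⊆G′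
  SatSeq-closed (e ∷ es) G⊆G′ closed (addable , sat) = SatSeq-closed es e∷G⊆G′ closed sat
    where
    e∷G⊆G′ = ⊆ₚ.∈-∷⁺ʳ (closed e (Addable-mono G⊆G′ addable)) G⊆G′

  record Closure (G : List (Subset n)) : Set where
    field
      added  : List (Subset n)
      satSeq : SatSeq ℋ G added
      unique : Unique added
      fresh  : All (_∉ G) added
      closed : Closed (added ʳ++ G)

  private
    addFirst : {G : List (Subset n)} {e : Subset n} → e ∉ G → Addable G e → Closure (e ∷ G) → Closure G
    addFirst e∉G addable c = record
      { added  = _ ∷ added
      ; satSeq = addable , satSeq
      ; unique = All.map (λ e′∉e∷G e≡e′ → e′∉e∷G (here (sym e≡e′))) fresh ∷ unique
      ; fresh  = e∉G ∷ All.map (_∘ there) fresh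
      ; closed = closed
      }
      where open Closure c

    -- R contains every subset outside G, and each step moves one edge from R to G
    grow : ∀ k (G R : List (Subset n)) → length R ≤ k → (∀ e → e ∉ G → e ∈ R) → Closure G
    grow k G R ∣R∣≤k R-covers with Any.any? (λ e → ¬? (e ∈? G) ×-dec addable? G e) R
    ... | no none = record { added = [] ; satSeq = _ ; unique = [] ; fresh = [] ; closed = closed }
      where
      closed : Closed G
      closed e addable with e ∈? G
      ... | yes e∈G = e∈G
      ... | no e∉G  = contradiction (lose (R-covers e e∉G) (e∉G , addable)) none
    ... | yes some with find some
    ... | e , e∈R , e∉G , addable with ∈-∃++ e∈R | k
    ...   | R₁ , R₂ , refl | zero  =
      contradiction (ℕ.≤-trans (ℕ.≤-reflexive (sym (List.length-++-sucʳ R₁ e R₂))) ∣R∣≤k) λ ()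
    ...   | R₁ , R₂ , refl | suc k = addFirst e∉G addable (grow k (e ∷ G) (R₁ ++ R₂) ∣R₁++R₂∣≤k R₁++R₂-covers)
      where
      ∣R₁++R₂∣≤k : length (R₁ ++ R₂) ≤ k
      ∣R₁++R₂∣≤k = ℕ.≤-pred (ℕ.≤-trans (ℕ.≤-reflexive (sym (List.length-++-sucʳ R₁ e R₂))) ∣R∣≤k)
      R₁++R₂-covers : ∀ e′ → e′ ∉ e ∷ G → e′ ∈ R₁ ++ R₂
      R₁++R₂-covers e′ e′∉e∷G with ∈-++⁻ R₁ (R-covers e′ (e′∉e∷G ∘ there))
      ... | inj₁ e′∈R₁          = ∈-++⁺ˡ e′∈R₁
      ... | inj₂ (here e′≡e)    = contradiction (here e′≡e) e′∉e∷G
      ... | inj₂ (there e′∈R₂) = ∈-++⁺ʳ R₁ e′∈R₂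

  closure : (G : List (Subset n)) → Closure G
  closure {n} G = grow _ G (subsets n) ℕ.≤-refl (λ e _ → ∈-subsets e)

  closure-complete⇒WeaklySaturated : (F : HG r n) → let open Closure (closure (edges F)) in
                                     Complete r (added ʳ++ edges F) → WeaklySaturated ℋ F
  closure-complete⇒WeaklySaturated F compl =
    added , unique , All.zip (SatSeq-sizes added satSeq , fresh) ,
    (λ e ∣e∣≡r e∉F → [ id , (λ e∈F → contradiction e∈F e∉F) ]′ (∈-ʳ++⁻ added (compl e ∣e∣≡r))) , satSeq
    where open Closure (closure (edges F))

  WeaklySaturated⇒complete : (F : HG r n) (ws : WeaklySaturated ℋ F) → Complete r (proj₁ ws ʳ++ edges F)
  WeaklySaturated⇒complete F (es , _ , _ , es-complete , _) e ∣e∣≡r with e ∈? edges F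
  ... | yes e∈F = ∈-ʳ++⁺ʳ es e∈F
  ... | no e∉F  = ∈-ʳ++⁺ˡ (edges F) (es-complete e ∣e∣≡r e∉F)

  WeaklySaturated⇒closure-complete : (F : HG r n) → WeaklySaturated ℋ F →
                                     let open Closure (closure (edges F)) in Complete r (added ʳ++ edges F)
  WeaklySaturated⇒closure-complete F ws@(es , _ , _ , _ , sat) e ∣e∣≡r =
    SatSeq-closed es (∈-ʳ++⁺ʳ added) closed sat (WeaklySaturated⇒complete F ws e ∣e∣≡r)
    where open Closure (closure (edges F))

  SatSeq-complete⇒WeaklySaturated : (F : HG r n) (es : List (Subset n)) → SatSeq ℋ (edges F) es →
                                    Complete r (es ʳ++ edges F) → WeaklySaturated ℋ F
  SatSeq-complete⇒WeaklySaturated F es sat compl = closure-complete⇒WeaklySaturated F λ e ∣e∣≡r →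
    SatSeq-closed es (∈-ʳ++⁺ʳ added) closed sat (compl e ∣e∣≡r)
    where open Closure (closure (edges F))

  weaklySaturated? : (F : HG r n) → Dec (WeaklySaturated ℋ F)
  weaklySaturated? F = map′ (closure-complete⇒WeaklySaturated F) (WeaklySaturated⇒closure-complete F)
                            (complete? _ (added ʳ++ edges F))
    where open Closure (closure (edges F))

  WeaklySaturated-mono : {F F′ : HG r n} → edges F ⊆ edges F′ → WeaklySaturated ℋ F → WeaklySaturated ℋ F′
  WeaklySaturated-mono {F = F} {F′} F⊆F′ ws@(es , _ , _ , _ , sat) =
    SatSeq-complete⇒WeaklySaturated F′ es (SatSeq-mono es F⊆F′ sat) λ e ∣e∣≡r →
      [ ∈-ʳ++⁺ˡ (edges F′) , ∈-ʳ++⁺ʳ es ∘ F⊆F′ ]′ (∈-ʳ++⁻ es (WeaklySaturated⇒complete F ws e ∣e∣≡r))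

  completeHG-weaklySaturated : ∀ n → WeaklySaturated ℋ (completeHG r n)
  completeHG-weaklySaturated n = SatSeq-complete⇒WeaklySaturated (completeHG r n) [] _
    λ e ∣e∣≡r → ∈-hypergraphOn⁺ (∈-subsets e) ∣e∣≡r

  wsat-exists : ∀ n → ∃[ k ] WsatIs ℋ n k
  wsat-exists n = size best , (best , best-ws , refl) , best-minimal
    where
    size : HG r n → ℕ
    size = length ∘ edges
    candidates : List (HG r n)
    candidates = filter weaklySaturated? (map (hypergraphOn r) (sublists (subsets n)))
    best : HG r n
    best = argmin size (completeHG r n) candidates
    best-ws : WeaklySaturated ℋ best
    best-ws = argmin-all size {xs = candidates} (completeHG-weaklySaturated n)
                (All.tabulate (proj₂ ∘ ∈-filter⁻ weaklySaturated?
                                         {xs = map (hypergraphOn r) (sublists (subsets n))}))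
    best-minimal : ∀ F → WeaklySaturated ℋ F → size best ≤ size F
    best-minimal F F-ws =
      ℕ.≤-trans (f[argmin]≤v⁺ {f = size} (completeHG r n) candidates (inj₂ (lose F₀∈ ℕ.≤-refl)))
                (Unique⇒length≤ (distinct F₀) F₀⊆F)
      where
      F₀ : HG r n
      F₀ = hypergraphOn r (filter (_∈? edges F) (subsets n))
      F⊆F₀ : edges F ⊆ edges F₀
      F⊆F₀ e∈F = ∈-hypergraphOn⁺ (∈-filter⁺ (_∈? edges F) (∈-subsets _) e∈F) (All.lookup (uniform F) e∈F)
      F₀⊆F : edges F₀ ⊆ edges F
      F₀⊆F e∈F₀ = proj₂ (∈-filter⁻ (_∈? edges F) {xs = subsets n}
                           (∈-hypergraphOn⁻ {r = r} {es = filter (_∈? edges F) (subsets n)} e∈F₀))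
      F₀∈ : F₀ ∈ candidates
      F₀∈ = ∈-filter⁺ weaklySaturated? (∈-map⁺ (hypergraphOn r) (filter∈sublists (_∈? edges F) (subsets n)))
                      (WeaklySaturated-mono {F = F} {F₀} F⊆F₀ F-ws)

-- Adding a vertex

sparseness1⇒pendant : {H : HG r m} → SparsenessIs (m , H) 1 → ∃[ v ] UniqueSuperedge H ⁅ v ⁆
sparseness1⇒pendant {H = H} ((S , ∣S∣≡1 , unique) , _) with ∣p∣≡1⇒p≡⁅x⁆ S ∣S∣≡1
... | v , refl = v , unique

image-suc : (a : Subset n) → image suc a ≡ outside ∷ a
image-suc a = sym (MapsOnto⇒≡image onto)
  where
  onto : MapsOnto suc a (outside ∷ a)
  onto zero    = mk⇔ (λ ()) (λ ())
  onto (suc y) = mk⇔ (λ where (there y∈a) → y , y∈a , refl) (λ where (x , x∈a , refl) → there x∈a)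

∣image-suc∣ : (a : Subset n) → ∣ image suc a ∣ ≡ ∣ a ∣
∣image-suc∣ a = ∣image∣≡∣d∣ suc a (λ _ _ → suc-injective)

zero∉⇒image-suc : (p : Subset (suc n)) → zero ∉ₛ p → p ≡ image suc (tail p)
zero∉⇒image-suc (inside ∷ p)  zero∉p = contradiction here zero∉p
zero∉⇒image-suc (outside ∷ p) _      = sym (image-suc p)

image-suc-injective : Injective _≡_ _≡_ (image {n = suc n} suc)
image-suc-injective {x = a} {b} eq = Vecₚ.∷-injectiveʳ (trans (sym (image-suc a)) (trans eq (image-suc b)))

module _ {r′ : ℕ} (ℋ : List (Hypergraph (suc r′))) {H : HG (suc r′) m} (H∈ℋ : (m , H) ∈ ℋ)
         {v : Fin m} (pendant : UniqueSuperedge H ⁅ v ⁆) where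

  private
    e₀ : Subset m
    e₀ = proj₁ pendant
    e₀∈H : e₀ ∈ edges H
    e₀∈H = proj₁ (proj₂ pendant)
    v∈e₀ : v ∈ₛ e₀
    v∈e₀ = proj₁ (proj₂ (proj₂ pendant)) (x∈⁅x⁆ v)
    only-e₀ : ∀ {d} → d ∈ edges H → v ∈ₛ d → d ≡ e₀
    only-e₀ {d} d∈H v∈d =
      proj₂ (proj₂ (proj₂ pendant)) d d∈H λ y∈⁅v⁆ → subst (_∈ₛ d) (sym (x∈⁅y⁆⇒x≡y v y∈⁅v⁆)) v∈d

  apex-addable : m ≤ suc n → {G : List (Subset (suc n))} → (∀ a → ∣ a ∣ ≡ suc r′ → image suc a ∈ G) →
                 (a : Subset n) → ∣ a ∣ ≡ r′ → Addable ℋ G (inside ∷ a)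
  apex-addable m≤1+n {G} G-complete a ∣a∣≡r′
    with injectionOnto-sending e₀ (inside ∷ a) v∈e₀ here
           (trans (All.lookup (uniform H) e₀∈H) (cong suc (sym ∣a∣≡r′))) m≤1+n
  ... | f , f-inj , f[e₀]≡a′ , fv≡0 =
    lose H∈ℋ (IsCopy⇒CopyContaining {H = H} (f-inj , All.tabulate f[d]∈ , lose e₀∈H f[e₀]≡a′))
    where
    f[d]∈ : ∀ {d} → d ∈ edges H → image f d ∈ (inside ∷ a) ∷ G
    f[d]∈ {d} d∈H with v ∈ₛ? d
    ... | yes v∈d = here (trans (cong (image f) (only-e₀ d∈H v∈d)) f[e₀]≡a′)
    ... | no v∉d = there (subst (_∈ G) (sym f[d]≡) (G-complete (tail (image f d)) ∣tail∣))
      where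
      zero∉f[d] : zero ∉ₛ image f d
      zero∉f[d] 0∈f[d] with ∈-image⁻ f d 0∈f[d]
      ... | x , x∈d , fx≡0 = v∉d (subst (_∈ₛ d) (f-inj (trans fx≡0 (sym fv≡0))) x∈d)
      f[d]≡ : image f d ≡ image suc (tail (image f d))
      f[d]≡ = zero∉⇒image-suc (image f d) zero∉f[d]
      ∣tail∣ : ∣ tail (image f d) ∣ ≡ suc r′
      ∣tail∣ = begin
        ∣ tail (image f d) ∣               ≡⟨ ∣image-suc∣ (tail (image f d)) ⟨
        ∣ image suc (tail (image f d)) ∣   ≡⟨ cong ∣_∣ f[d]≡ ⟨
        ∣ image f d ∣                      ≡⟨ ∣image∣≡∣d∣ f d (λ _ _ → f-inj) ⟩
        ∣ d ∣                              ≡⟨ All.lookup (uniform H) d∈H ⟩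
        suc r′                             ∎
        where open ≡-Reasoning

  apexes-satSeq : m ≤ suc n → (as : List (Subset n)) → All (λ a → ∣ a ∣ ≡ r′) as →
                  {G : List (Subset (suc n))} → (∀ a → ∣ a ∣ ≡ suc r′ → image suc a ∈ G) →
                  SatSeq ℋ G (map (inside ∷_) as)
  apexes-satSeq _     []       _               _          = _
  apexes-satSeq m≤1+n (a ∷ as) (∣a∣≡r′ ∷ ∣as∣) G-complete =
    apex-addable m≤1+n G-complete a ∣a∣≡r′ ,
    apexes-satSeq m≤1+n as ∣as∣ (λ b ∣b∣ → there (G-complete b ∣b∣))

  addVertex : m ≤ suc n → (F : HG (suc r′) n) → WeaklySaturated ℋ F →
         Σ (HG (suc r′) (suc n)) λ F′ → WeaklySaturated ℋ F′ × length (edges F′) ≡ length (edges F)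
  addVertex {n} m≤1+n F ws@(es , _ , _ , _ , sat) =
    F′ , SatSeq-complete⇒WeaklySaturated ℋ F′ (shifted ++ apexes) sat′ complete′ , List.length-map _ (edges F)
    where
    F′ : HG (suc r′) (suc n)
    F′ = record
      { edges    = map (image suc) (edges F)
      ; distinct = Unique.map⁺ image-suc-injective (distinct F)
      ; uniform  = Allₚ.map⁺ (All.map (λ {d} → trans (∣image-suc∣ d)) (uniform F))
      }
    shifted = map (image suc) es
    apexes  = map (inside ∷_) (edges (completeHG r′ n))
    shifted-complete : ∀ a → ∣ a ∣ ≡ suc r′ → image suc a ∈ shifted ʳ++ edges F′
    shifted-complete a ∣a∣≡r with ∈-ʳ++⁻ es (WeaklySaturated⇒complete ℋ F ws a ∣a∣≡r)
    ... | inj₁ a∈es = ∈-ʳ++⁺ˡ (edges F′) (∈-map⁺ (image suc) a∈es)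
    ... | inj₂ a∈F  = ∈-ʳ++⁺ʳ shifted (∈-map⁺ (image suc) a∈F)
    sat′ : SatSeq ℋ (edges F′) (shifted ++ apexes)
    sat′ = SatSeq-++ ℋ shifted apexes (SatSeq-image ℋ suc suc-injective es sat)
             (apexes-satSeq m≤1+n (edges (completeHG r′ n)) (uniform (completeHG r′ n)) shifted-complete)
    complete′ : Complete (suc r′) ((shifted ++ apexes) ʳ++ edges F′)
    complete′ X ∣X∣≡r rewrite List.++-ʳ++ shifted {apexes} {edges F′} with X
    ... | inside ∷ a  = ∈-ʳ++⁺ˡ _ (∈-map⁺ (inside ∷_) (∈-hypergraphOn⁺ (∈-subsets a) (ℕ.suc-injective ∣X∣≡r)))
    ... | outside ∷ a = ∈-ʳ++⁺ʳ apexes (subst (_∈ _) (image-suc a) (shifted-complete a ∣X∣≡r))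

-- Removing vertices

module Compression {r : ℕ} (ℋ : List (Hypergraph r)) {n₀ : ℕ} (ℋ≤n₀ : All (λ H → nVert H ≤ n₀) ℋ)
                   {n M : ℕ} (F : HG r n) (F-ws : WeaklySaturated ℋ F)
                   (room : r * length (edges F) + n₀ ≤ M) (default : Fin M)
                   (σ : Fin M → Fin n) (σ-inj : Injective _≡_ _≡_ σ)
                   (ρ : Fin n → Fin M) (ρσ≡id : ∀ x → ρ (σ x) ≡ x)
                   (U⊆σ[⊤] : ⋃ (edges F) ⊆ₛ image σ ⊤) where

  private
    U : Subset n
    U = ⋃ (edges F)

    ρ-inj : InjectiveOn ρ (image σ ⊤)
    ρ-inj y∈ y′∈ ρy≡ρy′ with ∈-image⁻ σ ⊤ y∈ | ∈-image⁻ σ ⊤ y′∈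
    ... | x , _ , refl | x′ , _ , refl = cong σ (trans (sym (ρσ≡id x)) (trans ρy≡ρy′ (ρσ≡id x′)))

    Admissible : (Fin n → Fin M) → Subset n → Set
    Admissible g X = InjectiveOn g (X ∪ U) × (∀ {y} → y ∈ₛ U → g y ≡ ρ y)

    Admissible-mono : ∀ {g X Y} → X ⊆ₛ Y → Admissible g Y → Admissible g X
    Admissible-mono X⊆Y (g-inj , g≗ρ) = (λ x∈ y∈ → g-inj (X∪U⊆Y∪U x∈) (X∪U⊆Y∪U y∈)) , g≗ρ
      where
      X∪U⊆Y∪U : _ ∪ U ⊆ₛ _ ∪ U
      X∪U⊆Y∪U x∈ = x∈p∪q⁺ ([ inj₁ ∘ X⊆Y , inj₂ ]′ (x∈p∪q⁻ _ U x∈))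

    ∣e∪U∪V∣≤M : ∀ {e V} → e ⊆ₛ V → ∣ V ∣ ≤ n₀ → ∣ (e ∪ U) ∪ V ∣ ≤ M
    ∣e∪U∪V∣≤M {e} {V} e⊆V ∣V∣≤n₀ = begin
      ∣ (e ∪ U) ∪ V ∣                ≤⟨ p⊆q⇒∣p∣≤∣q∣ e∪U∪V⊆U∪V ⟩
      ∣ U ∪ V ∣                      ≤⟨ ∣p∪q∣≤∣p∣+∣q∣ U V ⟩
      ∣ U ∣ + ∣ V ∣                  ≤⟨ ℕ.+-mono-≤ (∣⋃∣≤ (edges F) (uniform F)) ∣V∣≤n₀ ⟩
      r * length (edges F) + n₀      ≤⟨ room ⟩
      M                              ∎
      where
      open ℕ.≤-Reasoning
      e∪U∪V⊆U∪V : (e ∪ U) ∪ V ⊆ₛ U ∪ V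
      e∪U∪V⊆U∪V x∈ with x∈p∪q⁻ (e ∪ U) V x∈
      ... | inj₂ x∈V   = x∈p∪q⁺ (inj₂ x∈V)
      ... | inj₁ x∈e∪U = x∈p∪q⁺ ([ inj₂ ∘ e⊆V , inj₁ ]′ (x∈p∪q⁻ e U x∈e∪U))

    extend : ∀ {g e V} → Admissible g e → e ⊆ₛ V → ∣ V ∣ ≤ n₀ →
             ∃[ g′ ] (Admissible g′ V × (∀ {x} → x ∈ₛ e → g′ x ≡ g x))
    extend {g} {e} {V} (g-inj , g≗ρ) e⊆V ∣V∣≤n₀
      with extendInjection g (e ∪ U) V g-inj (∣e∪U∪V∣≤M e⊆V ∣V∣≤n₀) default
    ... | g′ , g′-inj , g′≗g =
      g′ , ((λ x∈ y∈ → g′-inj (V∪U⊆ x∈) (V∪U⊆ y∈)) , λ y∈U → trans (g′≗g (x∈p∪q⁺ (inj₂ y∈U))) (g≗ρ y∈U)) ,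
      g′≗g ∘ x∈p∪q⁺ ∘ inj₁
      where
      V∪U⊆ : V ∪ U ⊆ₛ (e ∪ U) ∪ V
      V∪U⊆ x∈ = x∈p∪q⁺ ([ inj₂ , inj₁ ∘ x∈p∪q⁺ ∘ inj₂ ]′ (x∈p∪q⁻ V U x∈))

    F′ : HG r M
    F′ = hypergraphOn r (map (image ρ) (edges F))

    open Closure (closure ℋ (edges F′))

    saturated : List (Subset M)
    saturated = added ʳ++ edges F′

    Transfers : List (Subset n) → Set
    Transfers G = ∀ {X} → X ∈ G → ∀ {g} → Admissible g X → image g X ∈ saturated

    transfers-F : Transfers (edges F)
    transfers-F {X} X∈F {g} (_ , g≗ρ) =
      subst (_∈ saturated) (sym g[X]≡ρ[X]) (∈-ʳ++⁺ʳ added (∈-hypergraphOn⁺ (∈-map⁺ (image ρ) X∈F) ∣ρ[X]∣≡r))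
      where
      X⊆U : X ⊆ₛ U
      X⊆U = ∈⇒⊆⋃ X∈F
      g[X]≡ρ[X] : image g X ≡ image ρ X
      g[X]≡ρ[X] = image-cong X (g≗ρ ∘ X⊆U)
      ∣ρ[X]∣≡r : ∣ image ρ X ∣ ≡ r
      ∣ρ[X]∣≡r = trans (∣image∣≡∣d∣ ρ X λ x∈X y∈X → ρ-inj (U⊆σ[⊤] (X⊆U x∈X)) (U⊆σ[⊤] (X⊆U y∈X)))
                       (All.lookup (uniform F) X∈F)

    transfer-copy : ∀ {m} {H : HG r m} {G e f g} → Transfers G → IsCopy H (e ∷ G) e f →
                    Admissible g (image f ⊤) → IsCopy H (image g e ∷ saturated) (image g e) (g ∘ f)
    transfer-copy {G = G} {e} {f} {g} transfers-G (f-inj , f[H]⊆e∷G , e∈f[H]) g-adm@(g-inj , _) =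
      f-inj ∘ g-inj (f∈V∪U _) (f∈V∪U _) ,
      All.map (λ {d} → g∘f[d]∈ {d}) f[H]⊆e∷G ,
      Any.map (λ {d} f[d]≡e → trans (image-∘ g f d) (cong (image g) f[d]≡e)) e∈f[H]
      where
      f∈V∪U : ∀ x → f x ∈ₛ image f ⊤ ∪ U
      f∈V∪U x = x∈p∪q⁺ (inj₁ (∈-image⁺ f ∈⊤))
      g∘f[d]∈ : ∀ {d} → image f d ∈ e ∷ G → image (g ∘ f) d ∈ image g e ∷ saturated
      g∘f[d]∈ {d} (here f[d]≡e) = here (trans (image-∘ g f d) (cong (image g) f[d]≡e))
      g∘f[d]∈ {d} (there f[d]∈G) =
        there (subst (_∈ saturated) (sym (image-∘ g f d))
                     (transfers-G f[d]∈G (Admissible-mono (image⊆range f d) g-adm)))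

    transfers-∷ : ∀ {G e} → Transfers G → Addable ℋ G e → Transfers (e ∷ G)
    transfers-∷ transfers-G _ (there X∈G) = transfers-G X∈G
    transfers-∷ {G} {e} transfers-G addable (here refl) {g} g-adm with find addable
    ... | (m , H) , H∈ℋ , copy with CopyContaining⇒IsCopy {H = H} copy
    ... | f , isCopy with extend g-adm e⊆V ∣V∣≤n₀
      where
      V = image f ⊤
      e⊆V : e ⊆ₛ V
      e⊆V = let d , _ , f[d]≡e = find (proj₂ (proj₂ isCopy)) in subst (_⊆ₛ V) f[d]≡e (image⊆range f d)
      ∣V∣≤n₀ : ∣ V ∣ ≤ n₀
      ∣V∣≤n₀ = ℕ.≤-trans (ℕ.≤-reflexive (trans (∣image∣≡∣d∣ f ⊤ (λ _ _ → proj₁ isCopy)) (∣⊤∣≡n m)))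
                         (All.lookup ℋ≤n₀ H∈ℋ)
    ... | g′ , g′-adm , g′≗g = closed (image g e) (lose H∈ℋ (IsCopy⇒CopyContaining {H = H}
            (subst (λ X → IsCopy H (X ∷ saturated) X (g′ ∘ f)) (image-cong e g′≗g)
                   (transfer-copy {H = H} transfers-G isCopy g′-adm))))

    transfers-satSeq : ∀ {G} es → Transfers G → SatSeq ℋ G es → Transfers (es ʳ++ G)
    transfers-satSeq []       transfers-G _                = transfers-G
    transfers-satSeq (e ∷ es) transfers-G (addable , sat) =
      transfers-satSeq es (transfers-∷ transfers-G addable) sat

    ρσ[x]≡x : ∀ x → image ρ (image σ x) ≡ x
    ρσ[x]≡x x = begin
      image ρ (image σ x)   ≡⟨ image-∘ ρ σ x ⟨
      image (ρ ∘ σ) x       ≡⟨ image-cong x (λ {y} _ → ρσ≡id y) ⟩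
      image (λ y → y) x     ≡⟨ image-id x ⟩
      x                     ∎
      where open ≡-Reasoning

    ρ-admissible : ∀ x → Admissible ρ (image σ x)
    ρ-admissible x = (λ y∈ y′∈ → ρ-inj (⊆σ[⊤] y∈) (⊆σ[⊤] y′∈)) , λ _ → refl
      where
      ⊆σ[⊤] : image σ x ∪ U ⊆ₛ image σ ⊤
      ⊆σ[⊤] y∈ = [ image⊆range σ x , U⊆σ[⊤] ]′ (x∈p∪q⁻ (image σ x) U y∈)

    F′-ws : WeaklySaturated ℋ F′
    F′-ws = closure-complete⇒WeaklySaturated ℋ F′ λ x ∣x∣≡r →
      subst (_∈ saturated) (ρσ[x]≡x x)
        (transfers-satSeq es transfers-F sat
          (WeaklySaturated⇒complete ℋ F F-ws (image σ x) (trans (∣image∣≡∣d∣ σ x (λ _ _ → σ-inj)) ∣x∣≡r))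
          (ρ-admissible x))
      where
      es = proj₁ F-ws
      sat = proj₂ (proj₂ (proj₂ (proj₂ F-ws)))

  compressed : Σ (HG r M) λ F′ → WeaklySaturated ℋ F′ × length (edges F′) ≤ length (edges F)
  compressed = F′ , F′-ws ,
    ℕ.≤-trans (∣hypergraphOn∣≤ r (map (image ρ) (edges F)))
              (ℕ.≤-reflexive (List.length-map (image ρ) (edges F)))

compress : ∀ {r} (ℋ : List (Hypergraph r)) {n₀} → All (λ H → nVert H ≤ n₀) ℋ →
           ∀ {n M} (F : HG r n) → WeaklySaturated ℋ F → r * length (edges F) + n₀ ≤ M → M ≤ n → Fin M →
           Σ (HG r M) λ F′ → WeaklySaturated ℋ F′ × length (edges F′) ≤ length (edges F)
compress ℋ {n₀} ℋ≤n₀ {n} {M} F F-ws room M≤n default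
  with subsetOfSize M (ℕ.≤-trans (∣⋃∣≤ (edges F) (uniform F)) (ℕ.≤-trans (ℕ.m≤m+n _ n₀) room))
... | A , ∣A∣≡∣U∣ with injectionOnto A (⋃ (edges F)) ∣A∣≡∣U∣ M≤n (inject≤ default M≤n)
... | σ , σ-inj , σ[A]≡U with leftInverse σ σ-inj default
... | ρ , ρσ≡id = Compression.compressed ℋ ℋ≤n₀ F F-ws room default σ σ-inj ρ ρσ≡id
                    (λ y∈U → image⊆range σ A (subst (_ ∈ₛ_) (sym σ[A]≡U) y∈U))

-- Stabilisation of wsat

module Stabilisation {r′ : ℕ} (ℋ : List (Hypergraph (suc r′))) {m : ℕ} {H : HG (suc r′) m}
                     (H∈ℋ : (m , H) ∈ ℋ) {v : Fin m} (pendant : UniqueSuperedge H ⁅ v ⁆) where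

  n₀ : ℕ
  n₀ = max 0 (map nVert ℋ)

  ℋ≤n₀ : All (λ H → nVert H ≤ n₀) ℋ
  ℋ≤n₀ = Allₚ.map⁻ (xs≤max 0 (map nVert ℋ))

  B : ℕ
  B = length (edges (completeHG (suc r′) n₀))

  -- B bounds wsat from above, and M leaves room to compress any F with fewer than B edges
  opaque
    M : ℕ
    M = suc (suc r′ * B + n₀)

    n₀≤M : n₀ ≤ M
    n₀≤M = ℕ.≤-trans (ℕ.m≤n+m n₀ (suc r′ * B)) (ℕ.n≤1+n _)

    <B⇒room : ∀ {k} → k < B → suc r′ * k + n₀ ≤ M
    <B⇒room k<B = ℕ.≤-trans (ℕ.+-monoˡ-≤ n₀ (ℕ.*-monoʳ-≤ (suc r′) (ℕ.<⇒≤ k<B))) (ℕ.n≤1+n (suc r′ * B + n₀))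

    zeroᴹ : Fin M
    zeroᴹ = zero

  WeaklySaturatedWithin : ℕ → ℕ → Set
  WeaklySaturatedWithin n k = ∃[ F ] (WeaklySaturated {suc r′} {n} ℋ F × length (edges F) ≤ k)

  addVertices : ∀ {n n′ k} → n₀ ≤ n → n ≤′ n′ → WeaklySaturatedWithin n k → WeaklySaturatedWithin n′ k
  addVertices n₀≤n ≤′-refl within = within
  addVertices {n} n₀≤n (≤′-step {n′} n≤′n′) within with addVertices n₀≤n n≤′n′ within
  ... | F , ws , ∣F∣≤k with addVertex ℋ H∈ℋ pendant m≤1+n′ F ws
    where
    m≤1+n′ : m ≤ suc n′
    m≤1+n′ = ℕ.≤-trans (All.lookup ℋ≤n₀ H∈ℋ) (ℕ.≤-trans n₀≤n (ℕ.≤-trans (ℕ.≤′⇒≤ n≤′n′) (ℕ.n≤1+n n′)))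
  ... | F′ , ws′ , ∣F′∣≡∣F∣ = F′ , ws′ , ℕ.≤-trans (ℕ.≤-reflexive ∣F′∣≡∣F∣) ∣F∣≤k

  completeHG-within : WeaklySaturatedWithin M B
  completeHG-within = addVertices ℕ.≤-refl (ℕ.≤⇒≤′ n₀≤M)
                      (completeHG (suc r′) n₀ , completeHG-weaklySaturated ℋ n₀ , ℕ.≤-refl)

  compress-within : ∀ {n k} → M ≤ n → k < B → WeaklySaturatedWithin n k → WeaklySaturatedWithin M k
  compress-within M≤n k<B (F , ws , ∣F∣≤k) =
    let F′ , ws′ , ∣F′∣≤∣F∣ = compress ℋ ℋ≤n₀ F ws (<B⇒room (ℕ.≤-<-trans ∣F∣≤k k<B)) M≤n zeroᴹ in
    F′ , ws′ , ℕ.≤-trans ∣F′∣≤∣F∣ ∣F∣≤k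

  moveTo-M : ∀ {n k} → n₀ ≤ n → WeaklySaturatedWithin n k → WeaklySaturatedWithin M k
  moveTo-M {n} {k} n₀≤n within with n ℕ.≤? M | B ℕ.≤? k
  ... | yes n≤M | _       = addVertices n₀≤n (ℕ.≤⇒≤′ n≤M) within
  ... | no _    | yes B≤k = let F , ws , ∣F∣≤B = completeHG-within in F , ws , ℕ.≤-trans ∣F∣≤B B≤k
  ... | no n≰M  | no B≰k  = compress-within (ℕ.<⇒≤ (ℕ.≰⇒> n≰M)) (ℕ.≰⇒> B≰k) within

  C : ℕ
  C = proj₁ (wsat-exists ℋ M)

  wsat-lower : ∀ {n} → n₀ ≤ n → (F : HG (suc r′) n) → WeaklySaturated ℋ F → C ≤ length (edges F)
  wsat-lower n₀≤n F ws = let F′ , ws′ , ∣F′∣≤∣F∣ = moveTo-M n₀≤n (F , ws , ℕ.≤-refl) in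
    ℕ.≤-trans (proj₂ (proj₂ (wsat-exists ℋ M)) F′ ws′) ∣F′∣≤∣F∣

  wsat-stable : ∀ n → n ≥ M → WsatIs ℋ n C
  wsat-stable n M≤n =
    let F , ws , ∣F∣≡C = proj₁ (proj₂ (wsat-exists ℋ M))
        F′ , ws′ , ∣F′∣≤C = addVertices n₀≤M (ℕ.≤⇒≤′ M≤n) (F , ws , ℕ.≤-reflexive ∣F∣≡C)
    in (F′ , ws′ , ℕ.≤-antisym ∣F′∣≤C (wsat-lower n₀≤n F′ ws′)) , wsat-lower n₀≤n
    where
    n₀≤n : n₀ ≤ n
    n₀≤n = ℕ.≤-trans n₀≤M M≤n

proposition2p9 : (r : ℕ) → 1 ≤ r → (ℋ : List (Hypergraph r)) → ¬ (ℋ ≡ []) →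
    All NonEmpty ℋ →
    Any (λ H → SparsenessIs H 1) ℋ →
    All (λ H → ∀ k → SparsenessIs H k → 1 ≤ k) ℋ →
    ∃[ C ] ((∃[ N ] (∀ n → n ≥ N → WsatIs ℋ n C)) ×
            (∀ n → All (λ H → nVert H ≤ n) ℋ → ∀ k → WsatIs ℋ n k → C ≤ k))
proposition2p9 (suc r′) _ ℋ _ _ sparseness-one _ with find sparseness-one
... | (m , H) , H∈ℋ , s[H]≡1 with sparseness1⇒pendant {H = H} s[H]≡1
... | v , pendant = C , (M , wsat-stable) , wsat-lower-bound
  where
  open Stabilisation ℋ H∈ℋ pendant
  wsat-lower-bound : ∀ n → All (λ H → nVert H ≤ n) ℋ → ∀ k → WsatIs ℋ n k → C ≤ k
  wsat-lower-bound n ℋ≤n k ((F , ws , ∣F∣≡k) , _) =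
    ℕ.≤-trans (wsat-lower (max≤v⁺ z≤n (Allₚ.map⁺ ℋ≤n)) F ws) (ℕ.≤-reflexive ∣F∣≡k)
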